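{- Let $r,n \in \mathbb{N}$, let $0<d,\alpha<1$ and $0 < 1/n \ll \rho \ll d,1/r$. Let $G$ be a $(\rho,d)$-dense graph on $n$ vertices and let $U \subseteq V(G)$ with $|U|=\alpha n$. Then (i) $G[U]$ is $(\rho/\alpha^2,d)$-dense; (ii) $G\setminus U$ is $(\rho/(1-\alpha)^2,d)$-dense; (iii) $G$ contains at least $dn/2$ vertices of degree at least $dn/2$; (iv) $G$ contains at least $(d/2)^{\binom{r+1}{2}}n^r/r!$ copies of $K_r$, each of which is $d^rn/2^r$-extendable.
   Context: A graph $G$ on $N$ vertices is $(\rho,d)$-dense if every $X \subseteq V(G)$ satisfies $e(G[X]) \geq d\binom{|X|}{2}-\rho N^2$ (here $N$ is the order of the graph in question, e.g. $|U|$ for $G[U]$). A subgraph $K\subseteq G$ is $s$-extendable if the common neighbourhood $\bigcap_{x\in V(K)}N_G(x)$ has size at least $s$. Hierarchy convention: "$0<1/n\ll\rho\ll d,1/r$" means there is a non-decreasing function $f$ and a function $g$ such that the statement holds whenever $\rho\le f(d,1/r)$ (i.e. $\rho$ sufficiently small relative to $d$ and $1/r$) and $1/n\le g(\rho)$.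
   Formalization: The parameters d and ρ are rational, and the hierarchy functions f and g take rational arguments and rational values. -}

module Defs where

open import Data.Bool using (Bool; true; false; _∧_; _∨_; not)
open import Data.Nat as ℕ using (ℕ; zero; suc; _<ᵇ_; _!)
open import Data.Nat.Properties using (_!≢0)
open import Data.Nat.Combinatorics using (_C_)
open import Data.Fin using (Fin; toℕ; _≟_)
open import Data.Fin.Subset using (Subset; ∣_∣)
open import Data.Vec using (lookup)
open import Data.List using (List; map; allFin; length)
open import Data.Nat.ListAction using (sum)
open import Data.Bool.ListAction using (and)
open import Data.List.Relation.Unary.All using (All)
open import Data.List.Relation.Unary.Unique.Propositional using (Unique)
open import Data.Integer using (+_)
open import Data.Rational as ℚ using (ℚ; 0ℚ; 1ℚ; _*_; _-_; _≤_; _÷_; ≢-nonZero)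
open import Data.Product using (Σ; _×_)
open import Relation.Nullary using (yes; no; ¬_)
open import Relation.Binary.PropositionalEquality using (_≡_; _≢_)

⟦_⟧ : ℕ → ℚ
⟦ n ⟧ = + n ℚ./ 1

_^ℚ_ : ℚ → ℕ → ℚ
q ^ℚ zero  = 1ℚ
q ^ℚ suc k = q * (q ^ℚ k)

-- p / q²  (total; the value at q = 0 is a dummy, only used with q ≠ 0)
_/²_ : ℚ → ℚ → ℚ
p /² q with q ℚ.≟ 0ℚ
... | yes _ = 0ℚ
... | no q≢0 = _÷_ (_÷_ p q {{≢-nonZero q≢0}}) q {{≢-nonZero q≢0}}

_/!_ : ℚ → ℕ → ℚ
q /! k = q * (+ 1 ℚ./ (k !)) {{k !≢0}}

record Graph (n : ℕ) : Set where
  field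
    adj    : Fin n → Fin n → Bool
    sym    : ∀ i j → adj i j ≡ adj j i
    irrefl : ∀ i → adj i i ≡ false
open Graph public

b2n : Bool → ℕ
b2n true  = 1
b2n false = 0

edgesIn : ∀ {n} → Graph n → Subset n → ℕ
edgesIn {n} G X =
  sum (map (λ i → sum (map (λ j →
    b2n ((toℕ i <ᵇ toℕ j) ∧ lookup X i ∧ lookup X j ∧ adj G i j))
    (allFin n))) (allFin n))

_⊆_ : ∀ {n} → Subset n → Subset n → Set
_⊆_ {n} X U = ∀ (i : Fin n) → lookup X i ≡ true → lookup U i ≡ true

-- G[U] is (ρ,d)-dense: every X ⊆ U satisfies
--   e(G[X]) ≥ d (|X| choose 2) − ρ |U|²    (N = |U| is the order of G[U])
DenseOn : ∀ {n} → Graph n → Subset n → ℚ → ℚ → Set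
DenseOn G U ρ d = ∀ X → X ⊆ U →
  d * ⟦ ∣ X ∣ C 2 ⟧ - ρ * ⟦ ∣ U ∣ ⟧ * ⟦ ∣ U ∣ ⟧ ≤ ⟦ edgesIn G X ⟧

Dense : ∀ {n} → Graph n → ℚ → ℚ → Set
Dense {n} G ρ d = ∀ X → d * ⟦ ∣ X ∣ C 2 ⟧ - ρ * ⟦ n ⟧ * ⟦ n ⟧ ≤ ⟦ edgesIn G X ⟧

degree : ∀ {n} → Graph n → Fin n → ℕ
degree {n} G v = sum (map (λ u → b2n (adj G v u)) (allFin n))

IsClique : ∀ {n} → Graph n → Subset n → Set
IsClique G K = ∀ i j → lookup K i ≡ true → lookup K j ≡ true → i ≢ j →
  adj G i j ≡ true

adjAll : ∀ {n} → Graph n → Subset n → Fin n → Bool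
adjAll {n} G K x = and (map (λ u → not (lookup K u) ∨ adj G x u) (allFin n))

commonNbhdSize : ∀ {n} → Graph n → Subset n → ℕ
commonNbhdSize {n} G K = sum (map (λ x → b2n (adjAll G K x)) (allFin n))

Extendable : ∀ {n} → Graph n → ℚ → Subset n → Set
Extendable G s K = s ≤ ⟦ commonNbhdSize G K ⟧

-- K is (the vertex set of) a copy of K_r in G
IsCopyOfK : ∀ {n} → Graph n → ℕ → Subset n → Set
IsCopyOfK G r K = ∣ K ∣ ≡ r × IsClique G K

module Submission where

-- (i), (ii) are immediate: with |U| = αn the error term (ρ/α²)|U|² of G[U]
-- is exactly ρn², so density of G restricts to every X ⊆ U.
-- The rest rests on a high-degree lemma: if t = d/2, τ = t|W| and
-- τ² - 2τ - 2ρn² > 0, then at least τ vertices of W have ≥ τ neighbours in W;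
-- otherwise the handshake lemma bounds 2e(G[W]) below what density demands.
-- W = V(G) gives (iii).  For (iv) call a k-clique good if its common
-- neighbourhood has ≥ t^k·n vertices; the lemma inside that neighbourhood
-- extends each good k-clique in ≥ t^(k+1)·n ways, and double counting gives
-- (k+1)·#good(k+1) ≥ t^(k+1)·n·#good(k), hence k!·#good(k) ≥ t^C(k+1,2)·n^k.

open import Defs hiding (sym)
import Data.Nat.Properties as ℕP
open import Algebra.Properties.Semiring.Sum ℕP.+-*-semiring
  using (sum; sum-syntax; ∑-distrib-+; ∑-comm; sum-cong-≗; sum-replicate-zero)
open import Data.Bool as B using (Bool; true; false; not; _∧_; _∨_)
open import Data.Bool.ListAction using (and)
open import Data.Empty using (⊥-elim)
open import Data.Fin using (Fin; zero; suc; toℕ; _≟_)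
import Data.Fin.Properties as FinP
open import Data.Fin.Subset using (Subset; ∣_∣; ⊤; ∁)
import Data.Fin.Subset as Sub
import Data.Fin.Subset.Properties as SubP
open import Data.Integer as ℤ using (+_)
import Data.Integer.Properties as ℤP
open import Data.List as List using (List; []; _∷_; _++_; map; allFin; tabulate; length; filter)
import Data.List.Properties as ListP
open import Data.List.Membership.Propositional using (_∈_)
open import Data.List.Membership.Propositional.Properties using (∈-map⁻)
open import Data.List.Relation.Unary.All as All using (All)
import Data.List.Relation.Unary.All.Properties as AllP
import Data.List.Relation.Unary.AllPairs as AllPairs
open import Data.List.Relation.Unary.Unique.Propositional using (Unique)
import Data.List.Relation.Unary.Unique.Propositional.Properties as UniqueP
open import Data.Nat as ℕ using (ℕ; zero; suc; _≥_; _!; NonZero; _<ᵇ_)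
open import Data.Nat.Combinatorics using (_C_; nCk+nC[k+1]≡[n+1]C[k+1]; nC1≡n)
open import Data.Nat.Coprimality as Coprimality using (Coprime; 1-coprimeTo)
import Data.Nat.ListAction as ListSum
import Data.Nat.ListAction.Properties as ListSumP
import Data.Nat.Solver as ℕSolver
open import Data.Product using (Σ; _×_; _,_; proj₁; proj₂)
open import Data.Rational as ℚ using (ℚ; mkℚ; _+_; _*_; _-_; _≤_; _<_; 0ℚ; 1ℚ; ½; ≢-nonZero)
import Data.Rational.Properties as ℚP
import Data.Rational.Solver as ℚSolver
import Data.Rational.Unnormalised as ℚᵘ
import Data.Rational.Unnormalised.Properties as ℚᵘP
open import Data.Unit using (tt)
open import Data.Vec as Vec using ([]; _∷_; lookup)
import Data.Vec.Properties as VecP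
open import Function using (_∘_)
open import Relation.Binary using (tri<; tri≈; tri>)
open import Relation.Binary.PropositionalEquality
open import Relation.Nullary using (¬_; Dec; yes; no; does; ¬?; _×-dec_; _→-dec_)
open import Relation.Nullary.Decidable using (toWitness; decidable-stable)

open ℚSolver.+-*-Solver using (solve; _:+_; _:*_; _:-_; _:=_; con)

-- n/1 is already in lowest terms, so ⟦ n ⟧ is the raw fraction n/1.
coprime-1 : ∀ n → Coprime n 1
coprime-1 n = Coprimality.sym (1-coprimeTo n)

⟦⟧≡mkℚ : ∀ n → ⟦ n ⟧ ≡ mkℚ (+ n) 0 (coprime-1 n)
⟦⟧≡mkℚ n = ℚP.normalize-coprime (coprime-1 n)

⟦⟧-homo-+ : ∀ a b → ⟦ a ℕ.+ b ⟧ ≡ ⟦ a ⟧ + ⟦ b ⟧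
⟦⟧-homo-+ a b rewrite ⟦⟧≡mkℚ a | ⟦⟧≡mkℚ b | ⟦⟧≡mkℚ (a ℕ.+ b) =
  ℚP.toℚᵘ-injective (ℚᵘP.≃-trans (ℚᵘ.*≡* cross) (ℚᵘP.≃-sym (ℚP.toℚᵘ-homo-+ (mkℚ (+ a) 0 (coprime-1 a)) (mkℚ (+ b) 0 (coprime-1 b)))))
  where
  cross : (+ a ℤ.+ + b) ℤ.* + 1 ≡ (+ a ℤ.* + 1 ℤ.+ + b ℤ.* + 1) ℤ.* + 1
  cross = cong (ℤ._* + 1) (sym (cong₂ ℤ._+_ (ℤP.*-identityʳ (+ a)) (ℤP.*-identityʳ (+ b))))

⟦⟧-homo-* : ∀ a b → ⟦ a ℕ.* b ⟧ ≡ ⟦ a ⟧ * ⟦ b ⟧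
⟦⟧-homo-* a b rewrite ⟦⟧≡mkℚ a | ⟦⟧≡mkℚ b | ⟦⟧≡mkℚ (a ℕ.* b) =
  ℚP.toℚᵘ-injective (ℚᵘP.≃-trans (ℚᵘ.*≡* cross) (ℚᵘP.≃-sym (ℚP.toℚᵘ-homo-* (mkℚ (+ a) 0 (coprime-1 a)) (mkℚ (+ b) 0 (coprime-1 b)))))
  where
  cross : + (a ℕ.* b) ℤ.* + 1 ≡ (+ a ℤ.* + b) ℤ.* + 1
  cross = cong (ℤ._* + 1) (ℤP.pos-* a b)

⟦⟧-nonNeg : ∀ n → 0ℚ ≤ ⟦ n ⟧
⟦⟧-nonNeg n = ℚP.nonNegative⁻¹ ⟦ n ⟧ {{ℚP.normalize-nonNeg n 1}}

p≤q⇒0≤q-p : ∀ {p q} → p ≤ q → 0ℚ ≤ q - p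
p≤q⇒0≤q-p {p} {q} p≤q = subst (_≤ q - p) (ℚP.+-inverseʳ p) (ℚP.+-monoˡ-≤ (ℚ.- p) p≤q)

0≤q-p⇒p≤q : ∀ {p q} → 0ℚ ≤ q - p → p ≤ q
0≤q-p⇒p≤q {p} {q} h = subst₂ _≤_ (ℚP.+-identityˡ p) (solve 2 (λ q p → (q :- p) :+ p := q) refl q p) (ℚP.+-monoˡ-≤ p h)

p<q⇒0<q-p : ∀ {p q} → p < q → 0ℚ < q - p
p<q⇒0<q-p {p} {q} p<q = subst (_< q - p) (ℚP.+-inverseʳ p) (ℚP.+-monoˡ-< (ℚ.- p) p<q)

≰⇒≥ : ∀ {p q} → ¬ p ≤ q → q ≤ p
≰⇒≥ p≰q = ℚP.<⇒≤ (ℚP.≰⇒> p≰q)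

+-nonNeg : ∀ {p q} → 0ℚ ≤ p → 0ℚ ≤ q → 0ℚ ≤ p + q
+-nonNeg = ℚP.+-mono-≤

+-nonNeg-pos : ∀ {p q} → 0ℚ ≤ p → 0ℚ < q → 0ℚ < p + q
+-nonNeg-pos = ℚP.+-mono-≤-<

*-nonNeg : ∀ {p q} → 0ℚ ≤ p → 0ℚ ≤ q → 0ℚ ≤ p * q
*-nonNeg {p} {q} 0≤p 0≤q = ℚP.nonNegative⁻¹ (p * q)
  {{ℚP.nonNeg*nonNeg⇒nonNeg p {{ℚ.nonNegative 0≤p}} q {{ℚ.nonNegative 0≤q}}}}

*-pos : ∀ {p q} → 0ℚ < p → 0ℚ < q → 0ℚ < p * q
*-pos {p} {q} 0<p 0<q = ℚP.positive⁻¹ (p * q) {{ℚP.pos*pos⇒pos p {{ℚ.positive 0<p}} q {{ℚ.positive 0<q}}}}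

*-monoˡ-≤-0≤ : ∀ {r p q} → 0ℚ ≤ r → p ≤ q → r * p ≤ r * q
*-monoˡ-≤-0≤ {r} 0≤r = ℚP.*-monoˡ-≤-nonNeg r {{ℚ.nonNegative 0≤r}}

*-monoʳ-≤-0≤ : ∀ {r p q} → 0ℚ ≤ r → p ≤ q → p * r ≤ q * r
*-monoʳ-≤-0≤ {r} 0≤r = ℚP.*-monoʳ-≤-nonNeg r {{ℚ.nonNegative 0≤r}}

*-mono-≤-0≤ : ∀ {a b c e} → 0ℚ ≤ a → 0ℚ ≤ e → a ≤ b → c ≤ e → a * c ≤ b * e
*-mono-≤-0≤ 0≤a 0≤e a≤b c≤e = ℚP.≤-trans (*-monoˡ-≤-0≤ 0≤a c≤e) (*-monoʳ-≤-0≤ 0≤e a≤b)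

⟦⟧-mono : ∀ {a b} → a ℕ.≤ b → ⟦ a ⟧ ≤ ⟦ b ⟧
⟦⟧-mono {a} {b} a≤b = 0≤q-p⇒p≤q (subst (0ℚ ≤_) difference (⟦⟧-nonNeg (b ℕ.∸ a)))
  where
  difference : ⟦ b ℕ.∸ a ⟧ ≡ ⟦ b ⟧ - ⟦ a ⟧
  difference = begin
    ⟦ b ℕ.∸ a ⟧                    ≡⟨ solve 2 (λ x y → x := (x :+ y) :- y) refl ⟦ b ℕ.∸ a ⟧ ⟦ a ⟧ ⟩
    (⟦ b ℕ.∸ a ⟧ + ⟦ a ⟧) - ⟦ a ⟧  ≡⟨ cong (_- ⟦ a ⟧) (sym (⟦⟧-homo-+ (b ℕ.∸ a) a)) ⟩
    ⟦ b ℕ.∸ a ℕ.+ a ⟧ - ⟦ a ⟧      ≡⟨ cong (λ z → ⟦ z ⟧ - ⟦ a ⟧) (ℕP.m∸n+n≡m a≤b) ⟩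
    ⟦ b ⟧ - ⟦ a ⟧                  ∎
    where open ≡-Reasoning

/-bound : ∀ q x m .{{_ : NonZero m}} → q ≤ ⟦ m ⟧ * x → q * (+ 1 ℚ./ m) ≤ x
/-bound q x (suc m) q≤mx = begin
  q * m⁻¹                 ≤⟨ *-monoʳ-≤-0≤ 0≤m⁻¹ q≤mx ⟩
  (⟦ suc m ⟧ * x) * m⁻¹   ≡⟨ solve 3 (λ a x b → (a :* x) :* b := x :* (a :* b)) refl ⟦ suc m ⟧ x m⁻¹ ⟩
  x * (⟦ suc m ⟧ * m⁻¹)   ≡⟨ cong (x *_) m·m⁻¹≡1 ⟩
  x * 1ℚ                  ≡⟨ ℚP.*-identityʳ x ⟩
  x                       ∎
  where
  open ℚP.≤-Reasoning
  m⁻¹ = + 1 ℚ./ suc m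
  0≤m⁻¹ : 0ℚ ≤ m⁻¹
  0≤m⁻¹ = ℚP.nonNegative⁻¹ _ {{ℚP.normalize-nonNeg 1 (suc m)}}
  m·m⁻¹≡1 : ⟦ suc m ⟧ * m⁻¹ ≡ 1ℚ
  m·m⁻¹≡1 rewrite ⟦⟧≡mkℚ (suc m) | ℚP.normalize-coprime {1} {m} (1-coprimeTo (suc m)) =
    ℚP.toℚᵘ-injective (ℚᵘP.≃-trans (ℚP.toℚᵘ-homo-* (mkℚ (+ suc m) 0 (coprime-1 (suc m))) (mkℚ (+ 1) m (1-coprimeTo (suc m))))
      (ℚᵘ.*≡* cross))
    where
    cross : (+ suc m ℤ.* + 1) ℤ.* + 1 ≡ + 1 ℤ.* + (1 ℕ.* suc m)
    cross = trans (ℤP.*-identityʳ (+ suc m ℤ.* + 1)) (trans (ℤP.*-identityʳ (+ suc m))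
              (sym (trans (ℤP.*-identityˡ (+ (1 ℕ.* suc m))) (cong +_ (ℕP.*-identityˡ (suc m))))))

¼ ⅕ c4 c16 c20 : ℚ
¼ = + 1 ℚ./ 4
⅕ = + 1 ℚ./ 5
c4 = + 4 ℚ./ 1
c16 = + 16 ℚ./ 1
c20 = + 20 ℚ./ 1

0<½ : 0ℚ < ½
0<½ = toWitness {a? = 0ℚ ℚ.<? ½} tt

0<¼ : 0ℚ < ¼
0<¼ = toWitness {a? = 0ℚ ℚ.<? ¼} tt

0<⅕ : 0ℚ < ⅕
0<⅕ = toWitness {a? = 0ℚ ℚ.<? ⅕} tt

0≤4 : 0ℚ ≤ c4
0≤4 = toWitness {a? = 0ℚ ℚ.≤? c4} tt

0<16 : 0ℚ < c16
0<16 = toWitness {a? = 0ℚ ℚ.<? c16} tt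

0<20 : 0ℚ < c20
0<20 = toWitness {a? = 0ℚ ℚ.<? c20} tt

0≤20 : 0ℚ ≤ c20
0≤20 = ℚP.<⇒≤ 0<20

^-nonNeg : ∀ {t} k → 0ℚ ≤ t → 0ℚ ≤ t ^ℚ k
^-nonNeg zero    _   = toWitness {a? = 0ℚ ℚ.≤? 1ℚ} tt
^-nonNeg (suc k) 0≤t = *-nonNeg 0≤t (^-nonNeg k 0≤t)

^-pos : ∀ {t} k → 0ℚ < t → 0ℚ < t ^ℚ k
^-pos zero    _   = toWitness {a? = 0ℚ ℚ.<? 1ℚ} tt
^-pos (suc k) 0<t = *-pos 0<t (^-pos k 0<t)

^-≤1 : ∀ {t} k → 0ℚ ≤ t → t ≤ 1ℚ → t ^ℚ k ≤ 1ℚ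
^-≤1 zero    _   _   = ℚP.≤-refl
^-≤1 {t} (suc k) 0≤t t≤1 =
  ℚP.≤-trans (*-monoˡ-≤-0≤ 0≤t (^-≤1 k 0≤t t≤1)) (subst (_≤ 1ℚ) (sym (ℚP.*-identityʳ t)) t≤1)

^-antitone : ∀ {t} k j → 0ℚ ≤ t → t ≤ 1ℚ → k ℕ.≤ j → t ^ℚ j ≤ t ^ℚ k
^-antitone zero    j       0≤t t≤1 ℕ.z≤n       = ^-≤1 j 0≤t t≤1
^-antitone (suc k) (suc j) 0≤t t≤1 (ℕ.s≤s k≤j) = *-monoˡ-≤-0≤ 0≤t (^-antitone k j 0≤t t≤1 k≤j)

^-monoˡ : ∀ {s t} k → 0ℚ ≤ s → s ≤ t → s ^ℚ k ≤ t ^ℚ k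
^-monoˡ zero    _   _   = ℚP.≤-refl
^-monoˡ (suc k) 0≤s s≤t = *-mono-≤-0≤ 0≤s (^-nonNeg k (ℚP.≤-trans 0≤s s≤t)) s≤t (^-monoˡ k 0≤s s≤t)

^-+ : ∀ t a b → t ^ℚ (a ℕ.+ b) ≡ t ^ℚ a * t ^ℚ b
^-+ t zero    b = sym (ℚP.*-identityˡ _)
^-+ t (suc a) b = trans (cong (t *_) (^-+ t a b)) (sym (ℚP.*-assoc t (t ^ℚ a) (t ^ℚ b)))

^-distrib-* : ∀ x y k → (x * y) ^ℚ k ≡ x ^ℚ k * y ^ℚ k
^-distrib-* x y zero    = refl
^-distrib-* x y (suc k) = trans (cong ((x * y) *_) (^-distrib-* x y k))
  (solve 4 (λ x y a b → (x :* y) :* (a :* b) := (x :* a) :* (y :* b)) refl x y (x ^ℚ k) (y ^ℚ k))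

b2n-≤1 : ∀ b → b2n b ℕ.≤ 1
b2n-≤1 true  = ℕP.≤-refl
b2n-≤1 false = ℕ.z≤n

sum-mono : ∀ {n} {f g : Fin n → ℕ} → (∀ i → f i ℕ.≤ g i) → sum f ℕ.≤ sum g
sum-mono {zero}  _   = ℕ.z≤n
sum-mono {suc n} f≤g = ℕP.+-mono-≤ (f≤g zero) (sum-mono (f≤g ∘ suc))

sum-ones : ∀ n → ∑[ i < n ] 1 ≡ n
sum-ones zero    = refl
sum-ones (suc n) = cong suc (sum-ones n)

sum-allFin : ∀ {n} (g : Fin n → ℕ) → ListSum.sum (map g (allFin n)) ≡ sum g
sum-allFin {n} g = trans (cong ListSum.sum (ListP.map-tabulate (λ i → i) g)) (sum-tabulate g)
  where
  sum-tabulate : ∀ {m} (h : Fin m → ℕ) → ListSum.sum (tabulate h) ≡ sum h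
  sum-tabulate {zero}  h = refl
  sum-tabulate {suc m} h = cong (h zero ℕ.+_) (sum-tabulate (h ∘ suc))

∣∣≡sum : ∀ {n} (X : Subset n) → ∣ X ∣ ≡ ∑[ i < n ] b2n (lookup X i)
∣∣≡sum []          = refl
∣∣≡sum (true ∷ X)  = cong suc (∣∣≡sum X)
∣∣≡sum (false ∷ X) = ∣∣≡sum X

sum-bound : ∀ {n} (f a b : Fin n → ℕ) (x y : ℚ) →
  (∀ i → ⟦ f i ⟧ ≤ x * ⟦ a i ⟧ + y * ⟦ b i ⟧) →
  ⟦ sum f ⟧ ≤ x * ⟦ sum a ⟧ + y * ⟦ sum b ⟧
sum-bound {zero} f a b x y _ =
  ℚP.≤-reflexive (solve 2 (λ x y → con 0ℚ := x :* con 0ℚ :+ y :* con 0ℚ) refl x y)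
sum-bound {suc n} f a b x y bound = begin
  ⟦ f zero ℕ.+ sum (f ∘ suc) ⟧           ≡⟨ ⟦⟧-homo-+ (f zero) (sum (f ∘ suc)) ⟩
  ⟦ f zero ⟧ + ⟦ sum (f ∘ suc) ⟧         ≤⟨ ℚP.+-mono-≤ (bound zero) (sum-bound (f ∘ suc) (a ∘ suc) (b ∘ suc) x y (bound ∘ suc)) ⟩
  (x * a₀ + y * b₀) + (x * A + y * B)    ≡⟨ solve 6 (λ x y a₀ b₀ A B → (x :* a₀ :+ y :* b₀) :+ (x :* A :+ y :* B)
                                              := x :* (a₀ :+ A) :+ y :* (b₀ :+ B)) refl x y a₀ b₀ A B ⟩
  x * (a₀ + A) + y * (b₀ + B)            ≡⟨ sym (cong₂ (λ u v → x * u + y * v) (⟦⟧-homo-+ (a zero) (sum (a ∘ suc)))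
                                                                            (⟦⟧-homo-+ (b zero) (sum (b ∘ suc)))) ⟩
  x * ⟦ sum a ⟧ + y * ⟦ sum b ⟧          ∎
  where
  open ℚP.≤-Reasoning
  a₀ = ⟦ a zero ⟧
  b₀ = ⟦ b zero ⟧
  A = ⟦ sum (a ∘ suc) ⟧
  B = ⟦ sum (b ∘ suc) ⟧

∑ˢ : ∀ {n} → (Subset n → ℕ) → ℕ
∑ˢ {zero}  F = F []
∑ˢ {suc n} F = ∑ˢ (λ K → F (false ∷ K)) ℕ.+ ∑ˢ (λ K → F (true ∷ K))

∑ˢ-cong : ∀ {n} {F H : Subset n → ℕ} → (∀ K → F K ≡ H K) → ∑ˢ F ≡ ∑ˢ H
∑ˢ-cong {zero}  F≡H = F≡H []
∑ˢ-cong {suc n} F≡H = cong₂ ℕ._+_ (∑ˢ-cong (F≡H ∘ (false ∷_))) (∑ˢ-cong (F≡H ∘ (true ∷_)))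

∑ˢ-mono : ∀ {n} {F H : Subset n → ℕ} → (∀ K → F K ℕ.≤ H K) → ∑ˢ F ℕ.≤ ∑ˢ H
∑ˢ-mono {zero}  F≤H = F≤H []
∑ˢ-mono {suc n} F≤H = ℕP.+-mono-≤ (∑ˢ-mono (F≤H ∘ (false ∷_))) (∑ˢ-mono (F≤H ∘ (true ∷_)))

term≤∑ˢ : ∀ {n} (F : Subset n → ℕ) K → F K ℕ.≤ ∑ˢ F
term≤∑ˢ F []          = ℕP.≤-refl
term≤∑ˢ F (false ∷ K) = ℕP.≤-trans (term≤∑ˢ (F ∘ (false ∷_)) K) (ℕP.m≤m+n _ _)
term≤∑ˢ F (true ∷ K)  = ℕP.≤-trans (term≤∑ˢ (F ∘ (true ∷_)) K) (ℕP.m≤n+m _ _)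

∑ˢ-comm : ∀ {n m} (F : Subset n → Fin m → ℕ) → ∑ˢ (λ K → sum (F K)) ≡ ∑[ v < m ] ∑ˢ (λ K → F K v)
∑ˢ-comm {zero}  F = refl
∑ˢ-comm {suc n} F = trans (cong₂ ℕ._+_ (∑ˢ-comm (F ∘ (false ∷_))) (∑ˢ-comm (F ∘ (true ∷_))))
  (sym (∑-distrib-+ (λ v → ∑ˢ (λ K → F (false ∷ K) v)) (λ v → ∑ˢ (λ K → F (true ∷ K) v))))

∑ˢ-*ˡ : ∀ {n} c (F : Subset n → ℕ) → ∑ˢ (λ K → c ℕ.* F K) ≡ c ℕ.* ∑ˢ F
∑ˢ-*ˡ {zero}  c F = refl
∑ˢ-*ˡ {suc n} c F = trans (cong₂ ℕ._+_ (∑ˢ-*ˡ c (F ∘ (false ∷_))) (∑ˢ-*ˡ c (F ∘ (true ∷_))))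
  (sym (ℕP.*-distribˡ-+ c (∑ˢ (F ∘ (false ∷_))) (∑ˢ (F ∘ (true ∷_)))))

∑ˢ-bound : ∀ {n} (F H : Subset n → ℕ) (c : ℚ) → (∀ K → ⟦ F K ⟧ * c ≤ ⟦ H K ⟧) → ⟦ ∑ˢ F ⟧ * c ≤ ⟦ ∑ˢ H ⟧
∑ˢ-bound {zero}  F H c bound = bound []
∑ˢ-bound {suc n} F H c bound = begin
  ⟦ ∑ˢ F₀ ℕ.+ ∑ˢ F₁ ⟧ * c          ≡⟨ cong (_* c) (⟦⟧-homo-+ (∑ˢ F₀) (∑ˢ F₁)) ⟩
  (⟦ ∑ˢ F₀ ⟧ + ⟦ ∑ˢ F₁ ⟧) * c      ≡⟨ ℚP.*-distribʳ-+ c ⟦ ∑ˢ F₀ ⟧ ⟦ ∑ˢ F₁ ⟧ ⟩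
  ⟦ ∑ˢ F₀ ⟧ * c + ⟦ ∑ˢ F₁ ⟧ * c    ≤⟨ ℚP.+-mono-≤ (∑ˢ-bound F₀ H₀ c (bound ∘ (false ∷_))) (∑ˢ-bound F₁ H₁ c (bound ∘ (true ∷_))) ⟩
  ⟦ ∑ˢ H₀ ⟧ + ⟦ ∑ˢ H₁ ⟧            ≡⟨ sym (⟦⟧-homo-+ (∑ˢ H₀) (∑ˢ H₁)) ⟩
  ⟦ ∑ˢ H ⟧                         ∎
  where
  open ℚP.≤-Reasoning
  F₀ = F ∘ (false ∷_)
  F₁ = F ∘ (true ∷_)
  H₀ = H ∘ (false ∷_)
  H₁ = H ∘ (true ∷_)

-- Toggling membership of a fixed vertex is a bijection on subsets, so it
-- does not change a sum over all subsets.
toggle : ∀ {n} → Fin n → Subset n → Subset n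
toggle zero    (b ∷ K) = not b ∷ K
toggle (suc v) (b ∷ K) = b ∷ toggle v K

∑ˢ-toggle : ∀ {n} (v : Fin n) (F : Subset n → ℕ) → ∑ˢ F ≡ ∑ˢ (F ∘ toggle v)
∑ˢ-toggle zero    F = ℕP.+-comm (∑ˢ (F ∘ (false ∷_))) (∑ˢ (F ∘ (true ∷_)))
∑ˢ-toggle (suc v) F = cong₂ ℕ._+_ (∑ˢ-toggle v (F ∘ (false ∷_))) (∑ˢ-toggle v (F ∘ (true ∷_)))

toggle-self : ∀ {n} (v : Fin n) K → lookup (toggle v K) v ≡ not (lookup K v)
toggle-self zero    (b ∷ K) = refl
toggle-self (suc v) (b ∷ K) = toggle-self v K

toggle-other : ∀ {n} (v u : Fin n) K → u ≢ v → lookup (toggle v K) u ≡ lookup K u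
toggle-other zero    zero    K       u≢v = ⊥-elim (u≢v refl)
toggle-other zero    (suc u) (b ∷ K) _   = refl
toggle-other (suc v) zero    (b ∷ K) _   = refl
toggle-other (suc v) (suc u) (b ∷ K) u≢v = toggle-other v u K (u≢v ∘ cong suc)

toggle-size : ∀ {n} (v : Fin n) K → lookup K v ≡ false → ∣ toggle v K ∣ ≡ suc ∣ K ∣
toggle-size zero    (false ∷ K) _    = refl
toggle-size (suc v) (true ∷ K)  v∉K = cong suc (toggle-size v K v∉K)
toggle-size (suc v) (false ∷ K) v∉K = toggle-size v K v∉K

allSubsets : ∀ n → List (Subset n)
allSubsets zero    = [] ∷ []
allSubsets (suc n) = map (false ∷_) (allSubsets n) ++ map (true ∷_) (allSubsets n)

allSubsets-unique : ∀ n → Unique (allSubsets n)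
allSubsets-unique zero    = All.[] AllPairs.∷ AllPairs.[]
allSubsets-unique (suc n) =
  UniqueP.++⁺ (UniqueP.map⁺ (cong Vec.tail) (allSubsets-unique n))
              (UniqueP.map⁺ (cong Vec.tail) (allSubsets-unique n)) disjoint
  where
  disjoint : ∀ {K} → ¬ (K ∈ map (false ∷_) (allSubsets n) × K ∈ map (true ∷_) (allSubsets n))
  disjoint (K∈₀ , K∈₁) with ∈-map⁻ (false ∷_) K∈₀ | ∈-map⁻ (true ∷_) K∈₁
  ... | _ , _ , refl | _ , _ , ()

sum-allSubsets : ∀ {n} (F : Subset n → ℕ) → ListSum.sum (map F (allSubsets n)) ≡ ∑ˢ F
sum-allSubsets {zero}  F = ℕP.+-identityʳ (F [])
sum-allSubsets {suc n} F = begin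
  ListSum.sum (map F (map (false ∷_) A ++ map (true ∷_) A))
    ≡⟨ cong ListSum.sum (ListP.map-++ F (map (false ∷_) A) (map (true ∷_) A)) ⟩
  ListSum.sum (map F (map (false ∷_) A) ++ map F (map (true ∷_) A))
    ≡⟨ ListSumP.sum-++ (map F (map (false ∷_) A)) (map F (map (true ∷_) A)) ⟩
  ListSum.sum (map F (map (false ∷_) A)) ℕ.+ ListSum.sum (map F (map (true ∷_) A))
    ≡⟨ cong₂ (λ x y → ListSum.sum x ℕ.+ ListSum.sum y) (sym (ListP.map-∘ A)) (sym (ListP.map-∘ A)) ⟩
  ListSum.sum (map (F ∘ (false ∷_)) A) ℕ.+ ListSum.sum (map (F ∘ (true ∷_)) A)
    ≡⟨ cong₂ ℕ._+_ (sum-allSubsets (F ∘ (false ∷_))) (sum-allSubsets (F ∘ (true ∷_))) ⟩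
  ∑ˢ F ∎
  where
  open ≡-Reasoning
  A = allSubsets n

∧-true₁ : ∀ {a b} → (a ∧ b) ≡ true → a ≡ true
∧-true₁ {true} _ = refl

∧-true₂ : ∀ {a b} → (a ∧ b) ≡ true → b ≡ true
∧-true₂ {true} b≡true = b≡true

does-true : ∀ {P : Set} (P? : Dec P) → does P? ≡ true → P
does-true (yes p) _ = p

does-false : ∀ {P : Set} (P? : Dec P) → does P? ≡ false → ¬ P
does-false (no ¬p) _ = ¬p

𝟙 : ∀ {P : Set} → Dec P → ℕ
𝟙 P? = b2n (does P?)

𝟙-yes : ∀ {P : Set} (P? : Dec P) → P → 𝟙 P? ≡ 1
𝟙-yes (yes _) _ = refl
𝟙-yes (no ¬p) p = ⊥-elim (¬p p)

𝟙-guard-bound : ∀ {n} {P : Set} (P? : Dec P) (c : ℚ) (f : Fin n → Bool) →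
  (P → c ≤ ⟦ ∑[ v < n ] b2n (f v) ⟧) → ⟦ 𝟙 P? ⟧ * c ≤ ⟦ ∑[ v < n ] b2n (does P? ∧ f v) ⟧
𝟙-guard-bound {n} (yes p) c f bound = ℚP.≤-trans (ℚP.≤-reflexive (ℚP.*-identityˡ c)) (bound p)
𝟙-guard-bound {n} (no _)  c f _     = ℚP.≤-reflexive (trans (ℚP.*-zeroˡ c) (cong ⟦_⟧ (sym (sum-replicate-zero n))))

𝟙-guard-sum : ∀ {n} {P : Set} (P? : Dec P) (K : Subset n) m → (P → ∣ K ∣ ≡ m) →
  ∑[ v < n ] b2n (does P? ∧ lookup K v) ≡ m ℕ.* 𝟙 P?
𝟙-guard-sum {n} (yes p) K m size = trans (sym (∣∣≡sum K)) (trans (size p) (sym (ℕP.*-identityʳ m)))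
𝟙-guard-sum {n} (no _)  K m _    = trans (sum-replicate-zero n) (sym (ℕP.*-zeroʳ m))

𝟙-guard-mono : ∀ {P Q : Set} (P? : Dec P) (Q? : Dec Q) (a b : Bool) →
  (P → a ≡ true → Q × b ≡ true) → b2n (does P? ∧ a) ℕ.≤ b2n (does Q? ∧ b)
𝟙-guard-mono (no _)  _       _     _ _ = ℕ.z≤n
𝟙-guard-mono (yes _) _       false _ _ = ℕ.z≤n
𝟙-guard-mono (yes p) (yes _) true  b ⇒ rewrite proj₂ (⇒ p refl) = ℕP.≤-refl
𝟙-guard-mono (yes p) (no ¬q) true  b ⇒ = ⊥-elim (¬q (proj₁ (⇒ p refl)))

length-filter : ∀ {A : Set} {P : A → Set} (P? : ∀ x → Dec (P x)) xs →
  length (filter P? xs) ≡ ListSum.sum (map (𝟙 ∘ P?) xs)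
length-filter P? []       = refl
length-filter P? (x ∷ xs) with does (P? x)
... | true  = cong suc (length-filter P? xs)
... | false = length-filter P? xs

C2-suc : ∀ w → suc w C 2 ≡ w ℕ.+ w C 2
C2-suc w = trans (sym (nCk+nC[k+1]≡[n+1]C[k+1] w 1)) (cong (ℕ._+ w C 2) (nC1≡n w))

-- 2·(w choose 2) + w = w², the form in which density enters the counting.
2·C2+n≡n² : ∀ w → (w C 2) ℕ.+ (w C 2) ℕ.+ w ≡ w ℕ.* w
2·C2+n≡n² zero    = refl
2·C2+n≡n² (suc w) = begin
  suc w C 2 ℕ.+ suc w C 2 ℕ.+ suc w              ≡⟨ cong (λ z → z ℕ.+ z ℕ.+ suc w) (C2-suc w) ⟩
  (w ℕ.+ w C 2) ℕ.+ (w ℕ.+ w C 2) ℕ.+ suc w      ≡⟨ regroup (w C 2) w ⟩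
  (w C 2 ℕ.+ w C 2 ℕ.+ w) ℕ.+ (w ℕ.+ suc w)      ≡⟨ cong (ℕ._+ (w ℕ.+ suc w)) (2·C2+n≡n² w) ⟩
  w ℕ.* w ℕ.+ (w ℕ.+ suc w)                      ≡⟨ square w ⟩
  suc w ℕ.* suc w                                ∎
  where
  open ≡-Reasoning
  open ℕSolver.+-*-Solver using () renaming (solve to ℕsolve; _:+_ to _⊕_; _:*_ to _⊗_; _:=_ to _⊜_; con to ℕcon)
  regroup : ∀ c w → (w ℕ.+ c) ℕ.+ (w ℕ.+ c) ℕ.+ suc w ≡ (c ℕ.+ c ℕ.+ w) ℕ.+ (w ℕ.+ suc w)
  regroup = ℕsolve 2 (λ c w → (w ⊕ c) ⊕ (w ⊕ c) ⊕ (ℕcon 1 ⊕ w) ⊜ (c ⊕ c ⊕ w) ⊕ (w ⊕ (ℕcon 1 ⊕ w))) refl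
  square : ∀ w → w ℕ.* w ℕ.+ (w ℕ.+ suc w) ≡ suc w ℕ.* suc w
  square = ℕsolve 1 (λ w → w ⊗ w ⊕ (w ⊕ (ℕcon 1 ⊕ w)) ⊜ (ℕcon 1 ⊕ w) ⊗ (ℕcon 1 ⊕ w)) refl

<ᵇ-true : ∀ {m n} → m ℕ.< n → (m <ᵇ n) ≡ true
<ᵇ-true {m} {n} m<n with m <ᵇ n | ℕP.<⇒<ᵇ m<n
... | true | _ = refl

<ᵇ-false : ∀ {m n} → ¬ (m ℕ.< n) → (m <ᵇ n) ≡ false
<ᵇ-false {m} {n} m≮n with m <ᵇ n | ℕP.<ᵇ⇒< m n
... | false | _    = refl
... | true  | m<n = ⊥-elim (m≮n (m<n tt))

and-allFin⁻ : ∀ {n} (f : Fin n → Bool) → and (map f (allFin n)) ≡ true → ∀ i → f i ≡ true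
and-allFin⁻ f all = and-tabulate⁻ f (trans (sym (cong and (ListP.map-tabulate (λ i → i) f))) all)
  where
  and-tabulate⁻ : ∀ {m} (g : Fin m → Bool) → and (tabulate g) ≡ true → ∀ i → g i ≡ true
  and-tabulate⁻ {suc m} g all i with g zero in g₀
  and-tabulate⁻ {suc m} g all zero    | true = g₀
  and-tabulate⁻ {suc m} g all (suc i) | true = and-tabulate⁻ (g ∘ suc) all i

and-allFin⁺ : ∀ {n} (f : Fin n → Bool) → (∀ i → f i ≡ true) → and (map f (allFin n)) ≡ true
and-allFin⁺ f all = trans (cong and (ListP.map-tabulate (λ i → i) f)) (and-tabulate⁺ f all)
  where
  and-tabulate⁺ : ∀ {m} (g : Fin m → Bool) → (∀ i → g i ≡ true) → and (tabulate g) ≡ true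
  and-tabulate⁺ {zero}  g all = refl
  and-tabulate⁺ {suc m} g all rewrite all zero = and-tabulate⁺ (g ∘ suc) (all ∘ suc)

module GraphFacts {n} (G : Graph n) where

  degIn : Subset n → Fin n → ℕ
  degIn W v = ∑[ u < n ] b2n (lookup W u ∧ adj G v u)

  degIn-≤ : ∀ W v → degIn W v ℕ.≤ ∣ W ∣
  degIn-≤ W v = subst (degIn W v ℕ.≤_) (sym (∣∣≡sum W)) (sum-mono (λ u → ∧-≤ (lookup W u) (adj G v u)))
    where
    ∧-≤ : ∀ x y → b2n (x ∧ y) ℕ.≤ b2n x
    ∧-≤ true  y = b2n-≤1 y
    ∧-≤ false y = ℕ.z≤n

  degIn-⊤ : ∀ v → degIn ⊤ v ≡ degree G v
  degIn-⊤ v = trans (sum-cong-≗ (λ u → cong (λ z → b2n (z ∧ adj G v u)) (VecP.lookup-replicate u true)))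
                    (sym (sum-allFin (λ u → b2n (adj G v u))))

  handshake : ∀ X → edgesIn G X ℕ.+ edgesIn G X ≡ ∑[ i < n ] (b2n (lookup X i) ℕ.* degIn X i)
  handshake X = begin
    edgesIn G X ℕ.+ edgesIn G X                                  ≡⟨ cong₂ ℕ._+_ edges≡ edges≡ ⟩
    once ℕ.+ once                                                ≡⟨ cong (once ℕ.+_) (∑-comm e) ⟩
    once ℕ.+ ∑[ i < n ] ∑[ j < n ] e j i                         ≡⟨ sym (∑-distrib-+ (λ i → ∑[ j < n ] e i j) (λ i → ∑[ j < n ] e j i)) ⟩
    ∑[ i < n ] (∑[ j < n ] e i j ℕ.+ ∑[ j < n ] e j i)           ≡⟨ sum-cong-≗ (λ i → sym (∑-distrib-+ (e i) (λ j → e j i))) ⟩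
    ∑[ i < n ] ∑[ j < n ] (e i j ℕ.+ e j i)                      ≡⟨ sum-cong-≗ (λ i → trans (sum-cong-≗ (ordered-pairs i)) (pull i)) ⟩
    ∑[ i < n ] (b2n (lookup X i) ℕ.* degIn X i)                    ∎
    where
    open ≡-Reasoning
    e : Fin n → Fin n → ℕ
    e i j = b2n ((toℕ i <ᵇ toℕ j) ∧ lookup X i ∧ lookup X j ∧ adj G i j)
    once : ℕ
    once = ∑[ i < n ] ∑[ j < n ] e i j
    edges≡ : edgesIn G X ≡ once
    edges≡ = trans (sum-allFin (λ i → ListSum.sum (map (e i) (allFin n)))) (sum-cong-≗ (λ i → sum-allFin (e i)))
    ∧-swap : ∀ x y z → (x ∧ y ∧ z) ≡ (y ∧ x ∧ z)
    ∧-swap true  true  z = refl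
    ∧-swap true  false z = refl
    ∧-swap false true  z = refl
    ∧-swap false false z = refl
    ordered-pairs : ∀ i j → e i j ℕ.+ e j i ≡ b2n (lookup X i ∧ lookup X j ∧ adj G i j)
    ordered-pairs i j with ℕ.<-cmp (toℕ i) (toℕ j)
    ... | tri< i<j _ j≮i rewrite <ᵇ-true i<j | <ᵇ-false j≮i = ℕP.+-identityʳ _
    ... | tri> i≮j _ j<i rewrite <ᵇ-false i≮j | <ᵇ-true j<i | Graph.sym G i j =
      cong b2n (∧-swap (lookup X j) (lookup X i) (adj G j i))
    ... | tri≈ i≮j i≡j _ with FinP.toℕ-injective i≡j
    ...   | refl rewrite <ᵇ-false i≮j | Graph.irrefl G i with lookup X i
    ...     | true  = refl
    ...     | false = refl
    pull : ∀ i → ∑[ j < n ] b2n (lookup X i ∧ lookup X j ∧ adj G i j) ≡ b2n (lookup X i) ℕ.* degIn X i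
    pull i with lookup X i
    ... | true  = sym (ℕP.+-identityʳ _)
    ... | false = sum-replicate-zero n

  commonNbhd : Subset n → Subset n
  commonNbhd K = Vec.tabulate (adjAll G K)

  ∣commonNbhd∣ : ∀ K → ∣ commonNbhd K ∣ ≡ commonNbhdSize G K
  ∣commonNbhd∣ K = trans (∣∣≡sum (commonNbhd K))
    (trans (sum-cong-≗ (λ x → cong b2n (VecP.lookup∘tabulate (adjAll G K) x))) (sym (sum-allFin (λ x → b2n (adjAll G K x)))))

  ∈commonNbhd : ∀ K x → lookup (commonNbhd K) x ≡ true → adjAll G K x ≡ true
  ∈commonNbhd K x = trans (sym (VecP.lookup∘tabulate (adjAll G K) x))

  adjAll⁻ : ∀ K x → adjAll G K x ≡ true → ∀ u → lookup K u ≡ true → adj G x u ≡ true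
  adjAll⁻ K x all u u∈K with and-allFin⁻ (λ u → not (lookup K u) ∨ adj G x u) all u
  ... | adjacent rewrite u∈K = adjacent

  adjAll⁺ : ∀ K x → (∀ u → lookup K u ≡ true → adj G x u ≡ true) → adjAll G K x ≡ true
  adjAll⁺ K x all = and-allFin⁺ (λ u → not (lookup K u) ∨ adj G x u) each
    where
    each : ∀ u → (not (lookup K u) ∨ adj G x u) ≡ true
    each u with lookup K u in u∈K
    ... | false = refl
    ... | true  = all u u∈K

  isClique? : ∀ K → Dec (IsClique G K)
  isClique? K = FinP.all? λ i → FinP.all? λ j →
    (lookup K i B.≟ true) →-dec ((lookup K j B.≟ true) →-dec (¬? (i ≟ j) →-dec (adj G i j B.≟ true)))

  common-neighbour-∉ : ∀ K v → adjAll G K v ≡ true → lookup K v ≡ false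
  common-neighbour-∉ K v v~K with lookup K v in v∈K
  ... | false = refl
  ... | true  with () ← trans (sym (adjAll⁻ K v v~K v v∈K)) (Graph.irrefl G v)

  private
    toggle-⊆ : ∀ (K : Subset n) v u → u ≢ v → lookup (toggle v K) u ≡ true → lookup K u ≡ true
    toggle-⊆ K v u u≢v = trans (sym (toggle-other v u K u≢v))

  clique-extend : ∀ K v → IsClique G K → adjAll G K v ≡ true → IsClique G (toggle v K)
  clique-extend K v clique v~K i j i∈ j∈ i≢j with i ≟ v | j ≟ v
  ... | yes refl | yes refl = ⊥-elim (i≢j refl)
  ... | yes refl | no  j≢v  = adjAll⁻ K v v~K j (toggle-⊆ K v j j≢v j∈)
  ... | no  i≢v  | yes refl = trans (Graph.sym G i v) (adjAll⁻ K v v~K i (toggle-⊆ K v i i≢v i∈))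
  ... | no  i≢v  | no  j≢v  = clique i j (toggle-⊆ K v i i≢v i∈) (toggle-⊆ K v j j≢v j∈) i≢j

  common-nbhd-extend : ∀ K v → degIn (commonNbhd K) v ℕ.≤ commonNbhdSize G (toggle v K)
  common-nbhd-extend K v = subst (degIn (commonNbhd K) v ℕ.≤_)
    (sym (sum-allFin (λ x → b2n (adjAll G (toggle v K) x)))) (sum-mono (λ x → b2n-mono (x~K∪v x)))
    where
    b2n-mono : ∀ {x y} → (x ≡ true → y ≡ true) → b2n x ℕ.≤ b2n y
    b2n-mono {false} _   = ℕ.z≤n
    b2n-mono {true}  x⇒y rewrite x⇒y refl = ℕP.≤-refl
    x~K∪v : ∀ x → (lookup (commonNbhd K) x ∧ adj G v x) ≡ true → adjAll G (toggle v K) x ≡ true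
    x~K∪v x x∈ = adjAll⁺ (toggle v K) x adjacent
      where
      x~K : adjAll G K x ≡ true
      x~K = ∈commonNbhd K x (∧-true₁ x∈)
      v~x : adj G v x ≡ true
      v~x = ∧-true₂ {lookup (commonNbhd K) x} x∈
      adjacent : ∀ u → lookup (toggle v K) u ≡ true → adj G x u ≡ true
      adjacent u u∈ with u ≟ v
      ... | yes refl = trans (Graph.sym G x v) v~x
      ... | no  u≢v  = adjAll⁻ K x x~K u (toggle-⊆ K v u u≢v u∈)

-- The numerical condition under which the high-degree lemma applies to a
-- threshold τ when the density error term is R = ρn²: τ² - 2τ - 2R > 0.
Roomy : ℚ → ℚ → Set
Roomy R τ = 0ℚ < τ * τ - (τ + τ) - (R + R)

-- The arithmetic core of the high-degree lemma.  Let w = |W|, c = (w choose 2),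
-- e = e(G[W]) and let s be the number of vertices of W with degree ≥ τ = tw
-- inside W.  Density gives e ≥ 2t·c - R and the handshake lemma gives
-- 2e ≤ w·s + τ(w - s).  If moreover s ≤ τ, these force τ² - 2τ - 2R ≤ 0.
few-high-degree⇒¬roomy : ∀ (t w s e c R : ℚ) → t ≤ 1ℚ → 0ℚ ≤ w → c + c + w ≡ w * w →
  (t + t) * c - R ≤ e → e + e ≤ w * s + (t * w) * (w - s) → s ≤ t * w → ¬ Roomy R (t * w)
few-high-degree⇒¬roomy t w s e c R t≤1 0≤w 2c+w≡w² density handshake s≤τ roomy =
  ℚP.<-irrefl refl (subst (0ℚ <_) certificate (+-nonNeg-pos 0≤slack roomy))
  where
  τ = t * w
  0≤a₁ : 0ℚ ≤ e - ((t + t) * c - R)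
  0≤a₁ = p≤q⇒0≤q-p density
  0≤a₂ : 0ℚ ≤ (w * s + τ * (w - s)) - (e + e)
  0≤a₂ = p≤q⇒0≤q-p handshake
  0≤a₃ : 0ℚ ≤ τ - s
  0≤a₃ = p≤q⇒0≤q-p s≤τ
  0≤a₄ : 0ℚ ≤ w - τ
  0≤a₄ = subst (0ℚ ≤_) (solve 2 (λ t w → (con 1ℚ :- t) :* w := w :- t :* w) refl t w) (*-nonNeg (p≤q⇒0≤q-p t≤1) 0≤w)
  slack = (e - ((t + t) * c - R)) + (e - ((t + t) * c - R)) + ((w * s + τ * (w - s)) - (e + e)) + (τ - s) * (w - τ)
  0≤slack : 0ℚ ≤ slack
  0≤slack = +-nonNeg (+-nonNeg (+-nonNeg 0≤a₁ 0≤a₁) 0≤a₂) (*-nonNeg 0≤a₃ 0≤a₄)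
  -- 2·a₁ + a₂ + a₃·a₄ + (τ² - 2τ - 2R) = -2t·(2c + w - w²) = 0
  certificate : slack + (τ * τ - (τ + τ) - (R + R)) ≡ 0ℚ
  certificate = begin
    slack + (τ * τ - (τ + τ) - (R + R))
      ≡⟨ solve 6 (λ e c w s t R →
           (e :- ((t :+ t) :* c :- R)) :+ (e :- ((t :+ t) :* c :- R))
           :+ ((w :* s :+ (t :* w) :* (w :- s)) :- (e :+ e)) :+ ((t :* w) :- s) :* (w :- (t :* w))
           :+ ((t :* w) :* (t :* w) :- ((t :* w) :+ (t :* w)) :- (R :+ R))
           := (con 0ℚ :- (t :+ t)) :* ((c :+ c :+ w) :- w :* w)) refl e c w s t R ⟩
    (0ℚ - (t + t)) * ((c + c + w) - w * w)  ≡⟨ cong (λ z → (0ℚ - (t + t)) * (z - w * w)) 2c+w≡w² ⟩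
    (0ℚ - (t + t)) * (w * w - w * w)        ≡⟨ solve 2 (λ a x → (con 0ℚ :- a) :* (x :- x) := con 0ℚ) refl (t + t) (w * w) ⟩
    0ℚ                                      ∎
    where open ≡-Reasoning

split-bound : ∀ (x h : Bool) (k : ℕ) (w τ : ℚ) → ⟦ k ⟧ ≤ w → (h ≡ false → ⟦ k ⟧ ≤ τ) →
  ⟦ b2n x ℕ.* k ⟧ ≤ w * ⟦ b2n (x ∧ h) ⟧ + τ * ⟦ b2n (x ∧ not h) ⟧
split-bound false h     k w τ _   _   = ℚP.≤-reflexive (solve 2 (λ x y → con 0ℚ := x :* con 0ℚ :+ y :* con 0ℚ) refl w τ)
split-bound true  true  k w τ k≤w _   = subst (_≤ w * 1ℚ + τ * 0ℚ) (cong ⟦_⟧ (sym (ℕP.+-identityʳ k)))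
  (ℚP.≤-trans k≤w (ℚP.≤-reflexive (solve 2 (λ x y → x := x :* con 1ℚ :+ y :* con 0ℚ) refl w τ)))
split-bound true  false k w τ _   k≤τ = subst (_≤ w * 0ℚ + τ * 1ℚ) (cong ⟦_⟧ (sym (ℕP.+-identityʳ k)))
  (ℚP.≤-trans (k≤τ refl) (ℚP.≤-reflexive (solve 2 (λ x y → y := x :* con 0ℚ :+ y :* con 1ℚ) refl w τ)))

module HighDegree {n} (G : Graph n) (ρ d : ℚ) (dense : Dense G ρ d) where
  open GraphFacts G

  t : ℚ
  t = d * ½

  N : ℚ
  N = ⟦ n ⟧

  τ : Subset n → ℚ
  τ W = t * ⟦ ∣ W ∣ ⟧

  high? : ∀ W v → Dec (τ W ≤ ⟦ degIn W v ⟧)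
  high? W v = τ W ℚ.≤? ⟦ degIn W v ⟧

  highIn : Subset n → Subset n
  highIn W = Vec.tabulate (λ v → lookup W v ∧ does (high? W v))

  private
    hi lo : Subset n → Fin n → ℕ
    hi W v = b2n (lookup W v ∧ does (high? W v))
    lo W v = b2n (lookup W v ∧ not (does (high? W v)))

    ∣highIn∣≡ : ∀ W → ∣ highIn W ∣ ≡ sum (hi W)
    ∣highIn∣≡ W = trans (∣∣≡sum (highIn W))
      (sum-cong-≗ (λ v → cong b2n (VecP.lookup∘tabulate (λ v → lookup W v ∧ does (high? W v)) v)))

    hi+lo : ∀ W → sum (hi W) ℕ.+ sum (lo W) ≡ ∣ W ∣
    hi+lo W = trans (sym (∑-distrib-+ (hi W) (lo W)))
      (trans (sum-cong-≗ (λ v → split (lookup W v) (does (high? W v)))) (sym (∣∣≡sum W)))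
      where
      split : ∀ x y → b2n (x ∧ y) ℕ.+ b2n (x ∧ not y) ≡ b2n x
      split true  true  = refl
      split true  false = refl
      split false _     = refl

    -- a high vertex has at most |W| neighbours in W, a low one fewer than τ
    degree-split : ∀ W v → ⟦ b2n (lookup W v) ℕ.* degIn W v ⟧ ≤ ⟦ ∣ W ∣ ⟧ * ⟦ hi W v ⟧ + τ W * ⟦ lo W v ⟧
    degree-split W v = split-bound (lookup W v) (does (high? W v)) (degIn W v) ⟦ ∣ W ∣ ⟧ (τ W)
      (⟦⟧-mono (degIn-≤ W v)) (λ low → ≰⇒≥ {τ W} {⟦ degIn W v ⟧} (does-false (high? W v) low))

  double-edges≤ : ∀ W → let w = ⟦ ∣ W ∣ ⟧ ; s = ⟦ ∣ highIn W ∣ ⟧ in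
    ⟦ edgesIn G W ⟧ + ⟦ edgesIn G W ⟧ ≤ w * s + τ W * (w - s)
  double-edges≤ W = begin
    ⟦ edgesIn G W ⟧ + ⟦ edgesIn G W ⟧            ≡⟨ trans (sym (⟦⟧-homo-+ (edgesIn G W) (edgesIn G W))) (cong ⟦_⟧ (handshake W)) ⟩
    ⟦ ∑[ v < n ] (b2n (lookup W v) ℕ.* degIn W v) ⟧ ≤⟨ sum-bound (λ v → b2n (lookup W v) ℕ.* degIn W v) (hi W) (lo W) w (τ W) (degree-split W) ⟩
    w * ⟦ sum (hi W) ⟧ + τ W * ⟦ sum (lo W) ⟧     ≡⟨ cong₂ (λ a b → w * a + τ W * b) (cong ⟦_⟧ (sym (∣highIn∣≡ W))) lo≡ ⟩
    w * s + τ W * (w - s)                          ∎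
    where
    open ℚP.≤-Reasoning
    w = ⟦ ∣ W ∣ ⟧
    s = ⟦ ∣ highIn W ∣ ⟧
    lo≡ : ⟦ sum (lo W) ⟧ ≡ w - s
    lo≡ = begin-equality
      ⟦ sum (lo W) ⟧                                   ≡⟨ solve 2 (λ l h → l := (h :+ l) :- h) refl ⟦ sum (lo W) ⟧ ⟦ sum (hi W) ⟧ ⟩
      (⟦ sum (hi W) ⟧ + ⟦ sum (lo W) ⟧) - ⟦ sum (hi W) ⟧ ≡⟨ cong₂ _-_ (trans (sym (⟦⟧-homo-+ (sum (hi W)) (sum (lo W)))) (cong ⟦_⟧ (hi+lo W)))
                                                                       (cong ⟦_⟧ (sym (∣highIn∣≡ W))) ⟩
      w - s                                            ∎

  many-high : ∀ W → t ≤ 1ℚ → Roomy (ρ * N * N) (τ W) → τ W ≤ ⟦ ∣ highIn W ∣ ⟧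
  many-high W t≤1 roomy = decidable-stable (τ W ℚ.≤? s) λ few →
    few-high-degree⇒¬roomy t w s e c (ρ * N * N) t≤1 (⟦⟧-nonNeg ∣ W ∣) 2c+w≡w²
      (subst (λ z → z * c - ρ * N * N ≤ e) d≡t+t (dense W)) (double-edges≤ W) (≰⇒≥ {τ W} {s} few) roomy
    where
    w = ⟦ ∣ W ∣ ⟧
    s = ⟦ ∣ highIn W ∣ ⟧
    e = ⟦ edgesIn G W ⟧
    c = ⟦ ∣ W ∣ C 2 ⟧
    d≡t+t : d ≡ t + t
    d≡t+t = solve 1 (λ d → d := d :* con ½ :+ d :* con ½) refl d
    2c+w≡w² : c + c + w ≡ w * w
    2c+w≡w² = trans (sym (trans (⟦⟧-homo-+ (∣ W ∣ C 2 ℕ.+ ∣ W ∣ C 2) ∣ W ∣) (cong (_+ w) (⟦⟧-homo-+ (∣ W ∣ C 2) (∣ W ∣ C 2)))))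
                    (trans (cong ⟦_⟧ (2·C2+n≡n² ∣ W ∣)) (⟦⟧-homo-* ∣ W ∣ ∣ W ∣))

  highIn-⊆ : ∀ W v → lookup (highIn W) v ≡ true → lookup W v ≡ true × τ W ≤ ⟦ degIn W v ⟧
  highIn-⊆ W v v∈ = ∧-true₁ v∈′ , does-true (high? W v) (∧-true₂ {lookup W v} v∈′)
    where
    v∈′ : (lookup W v ∧ does (high? W v)) ≡ true
    v∈′ = trans (sym (VecP.lookup∘tabulate (λ v → lookup W v ∧ does (high? W v)) v)) v∈

-- Suppose τ ≥ P·n with 0 ≤ P ≤ 1, ρ ≤ P²/4
-- and ρn ≥ 5.  Then τ ≥ Pn ≥ 4ρn ≥ 20 and 2ρn² ≤ (Pn)²/2 ≤ τ²/2, so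
-- τ² - 2τ - 2ρn² ≥ τ(τ - 4)/2 > 0.  The certificate below writes
-- τ² - 2τ - 2ρn² as an explicitly nonnegative plus a positive expression
-- in the slacks of these hypotheses.
roomy-if-large : ∀ (τ ρ N P : ℚ) → 0ℚ ≤ P → P ≤ 1ℚ → P * N ≤ τ →
  ρ ≤ P * P * ¼ → 1ℚ ≤ ρ * ⅕ * N → 0ℚ ≤ N → Roomy (ρ * N * N) τ
roomy-if-large τ ρ N P 0≤P P≤1 PN≤τ ρ≤P²/4 5≤ρN 0≤N = subst (0ℚ <_) certificate (+-nonNeg-pos 0≤x 0<u)
  where
  q₁ = P * P * ¼ - ρ
  q₂ = ρ * ⅕ * N - 1ℚ
  q₃ = 1ℚ - P
  q₄ = τ - P * N
  0≤q₁ = p≤q⇒0≤q-p ρ≤P²/4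
  0≤q₂ = p≤q⇒0≤q-p 5≤ρN
  0≤q₃ = p≤q⇒0≤q-p P≤1
  0≤q₄ = p≤q⇒0≤q-p PN≤τ
  -- τ - 20 as a nonnegative combination of the slacks
  A = q₄ + P * q₃ * N + c4 * q₁ * N + c20 * q₂
  0≤A : 0ℚ ≤ A
  0≤A = +-nonNeg (+-nonNeg (+-nonNeg 0≤q₄ (*-nonNeg (*-nonNeg 0≤P 0≤q₃) 0≤N)) (*-nonNeg (*-nonNeg 0≤4 0≤q₁) 0≤N))
                 (*-nonNeg 0≤20 0≤q₂)
  0≤τ+PN : 0ℚ ≤ τ + P * N
  0≤τ+PN = +-nonNeg (ℚP.≤-trans (*-nonNeg 0≤P 0≤N) PN≤τ) (*-nonNeg 0≤P 0≤N)
  x = ½ * (q₄ * (τ + P * N) + c4 * q₁ * N * N)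
  u = ½ * ((A + c20) * (A + c16))
  0≤x : 0ℚ ≤ x
  0≤x = *-nonNeg (ℚP.<⇒≤ 0<½) (+-nonNeg (*-nonNeg 0≤q₄ 0≤τ+PN) (*-nonNeg (*-nonNeg (*-nonNeg 0≤4 0≤q₁) 0≤N) 0≤N))
  0<u : 0ℚ < u
  0<u = *-pos 0<½ (*-pos (+-nonNeg-pos 0≤A 0<20) (+-nonNeg-pos 0≤A 0<16))
  certificate : x + u ≡ τ * τ - (τ + τ) - (ρ * N * N + ρ * N * N)
  certificate = solve 4 (λ τ ρ N P →
      con ½ :* ((τ :- P :* N) :* (τ :+ P :* N) :+ con c4 :* (P :* P :* con ¼ :- ρ) :* N :* N)
      :+ con ½ :* (((τ :- P :* N) :+ P :* (con 1ℚ :- P) :* N :+ con c4 :* (P :* P :* con ¼ :- ρ) :* N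
                    :+ con c20 :* (ρ :* con ⅕ :* N :- con 1ℚ) :+ con c20)
                 :* ((τ :- P :* N) :+ P :* (con 1ℚ :- P) :* N :+ con c4 :* (P :* P :* con ¼ :- ρ) :* N
                    :+ con c20 :* (ρ :* con ⅕ :* N :- con 1ℚ) :+ con c16))
      := τ :* τ :- (τ :+ τ) :- (ρ :* N :* N :+ ρ :* N :* N)) refl τ ρ N P

module CliqueCount {n} (G : Graph n) (ρ d : ℚ) (dense : Dense G ρ d) where
  open GraphFacts G
  open HighDegree G ρ d dense

  Good : ℕ → Subset n → Set
  Good k K = IsCopyOfK G k K × Extendable G (t ^ℚ k * N) K

  good? : ∀ k K → Dec (Good k K)
  good? k K = ((∣ K ∣ ℕ.≟ k) ×-dec isClique? K) ×-dec (t ^ℚ k * N ℚ.≤? ⟦ commonNbhdSize G K ⟧)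

  #good : ℕ → ℕ
  #good k = ∑ˢ (𝟙 ∘ good? k)

  -- the empty set is a good 0-clique, so #good 0 ≥ 1
  #good-0 : 1 ℕ.≤ #good 0
  #good-0 = subst (ℕ._≤ #good 0) (𝟙-yes (good? 0 Sub.⊥) empty-good) (term≤∑ˢ (𝟙 ∘ good? 0) Sub.⊥)
    where
    ∉⊥ : ∀ i → lookup (Sub.⊥ {n}) i ≡ true → ∀ {A : Set} → A
    ∉⊥ i i∈ with () ← trans (sym i∈) (VecP.lookup-replicate i false)
    all-common : commonNbhdSize G Sub.⊥ ≡ n
    all-common = trans (sum-allFin (λ x → b2n (adjAll G Sub.⊥ x)))
      (trans (sum-cong-≗ (λ x → cong b2n (adjAll⁺ Sub.⊥ x (λ u u∈ → ∉⊥ u u∈)))) (sum-ones n))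
    empty-good : Good 0 Sub.⊥
    empty-good = (SubP.∣⊥∣≡0 n , λ i _ i∈ _ _ → ∉⊥ i i∈) ,
                 ℚP.≤-reflexive (trans (ℚP.*-identityˡ N) (cong ⟦_⟧ (sym all-common)))

  extend : ∀ k K v → 0ℚ ≤ t → Good k K → lookup (highIn (commonNbhd K)) v ≡ true →
           Good (suc k) (toggle v K) × lookup (toggle v K) v ≡ true
  extend k K v 0≤t ((∣K∣≡k , clique) , extendable) v∈high =
    ((trans (toggle-size v K v∉K) (cong suc ∣K∣≡k) , clique-extend K v clique v~K) , extendable′) ,
    trans (toggle-self v K) (cong not v∉K)
    where
    W = commonNbhd K
    v∈W = proj₁ (highIn-⊆ W v v∈high)
    v~K = ∈commonNbhd K v v∈W
    v∉K = common-neighbour-∉ K v v~K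
    extendable′ : t ^ℚ suc k * N ≤ ⟦ commonNbhdSize G (toggle v K) ⟧
    extendable′ = begin
      t ^ℚ suc k * N         ≡⟨ ℚP.*-assoc t (t ^ℚ k) N ⟩
      t * (t ^ℚ k * N)       ≤⟨ *-monoˡ-≤-0≤ 0≤t (subst (λ z → t ^ℚ k * N ≤ ⟦ z ⟧) (sym (∣commonNbhd∣ K)) extendable) ⟩
      τ W                    ≤⟨ proj₂ (highIn-⊆ W v v∈high) ⟩
      ⟦ degIn W v ⟧          ≤⟨ ⟦⟧-mono (common-nbhd-extend K v) ⟩
      ⟦ commonNbhdSize G (toggle v K) ⟧ ∎
      where open ℚP.≤-Reasoning

  -- Double counting of the pairs (K, v) with K a good k-clique and v a
  -- high-degree vertex of its common neighbourhood:
  --   #good k · t^(k+1) n ≤ #pairs ≤ (k+1) · #good (k+1).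
  module _ (k : ℕ) (0≤t : 0ℚ ≤ t) (t≤1 : t ≤ 1ℚ)
           (roomy : ∀ W → t ^ℚ k * N ≤ ⟦ ∣ W ∣ ⟧ → Roomy (ρ * N * N) (τ W)) where

    pair : Subset n → Fin n → ℕ
    pair K v = b2n (does (good? k K) ∧ lookup (highIn (commonNbhd K)) v)

    pair′ : Subset n → Fin n → ℕ
    pair′ K′ v = b2n (does (good? (suc k) K′) ∧ lookup K′ v)

    -- every good k-clique has at least t^(k+1) n high-degree common neighbours
    pairs-lower : ⟦ #good k ⟧ * (t ^ℚ suc k * N) ≤ ⟦ ∑ˢ (sum ∘ pair) ⟧
    pairs-lower = ∑ˢ-bound (𝟙 ∘ good? k) (sum ∘ pair) (t ^ℚ suc k * N)
      (λ K → 𝟙-guard-bound (good? k K) (t ^ℚ suc k * N) (lookup (highIn (commonNbhd K))) (many K))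
      where
      many : ∀ K → Good k K → t ^ℚ suc k * N ≤ ⟦ sum (b2n ∘ lookup (highIn (commonNbhd K))) ⟧
      many K (_ , extendable) = begin
        t ^ℚ suc k * N            ≡⟨ ℚP.*-assoc t (t ^ℚ k) N ⟩
        t * (t ^ℚ k * N)          ≤⟨ *-monoˡ-≤-0≤ 0≤t big ⟩
        τ W                       ≤⟨ many-high W t≤1 (roomy W big) ⟩
        ⟦ ∣ highIn W ∣ ⟧          ≡⟨ cong ⟦_⟧ (∣∣≡sum (highIn W)) ⟩
        ⟦ sum (b2n ∘ lookup (highIn W)) ⟧ ∎
        where
        open ℚP.≤-Reasoning
        W = commonNbhd K
        big : t ^ℚ k * N ≤ ⟦ ∣ W ∣ ⟧
        big = subst (λ z → t ^ℚ k * N ≤ ⟦ z ⟧) (sym (∣commonNbhd∣ K)) extendable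

    -- (K, v) ↦ (K ∪ {v}, v) is injective, and lands in pairs (K′, v ∈ K′)
    pairs-upper : ∑ˢ (sum ∘ pair) ℕ.≤ ∑ˢ (sum ∘ pair′)
    pairs-upper = subst₂ ℕ._≤_ (sym (∑ˢ-comm pair)) (sym (∑ˢ-comm pair′))
      (sum-mono (λ v → subst (∑ˢ (λ K → pair K v) ℕ.≤_) (sym (∑ˢ-toggle v (λ K′ → pair′ K′ v)))
        (∑ˢ-mono (λ K → 𝟙-guard-mono (good? k K) (good? (suc k) (toggle v K))
                           (lookup (highIn (commonNbhd K)) v) (lookup (toggle v K) v)
                           (λ good v∈high → extend k K v 0≤t good v∈high)))))

    -- each good (k+1)-clique K′ is counted once for each of its k+1 vertices
    pairs′≡ : ∑ˢ (sum ∘ pair′) ≡ suc k ℕ.* #good (suc k)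
    pairs′≡ = trans (∑ˢ-cong (λ K′ → 𝟙-guard-sum (good? (suc k) K′) K′ (suc k) (proj₁ ∘ proj₁)))
                    (∑ˢ-*ˡ (suc k) (𝟙 ∘ good? (suc k)))

    extension-step : ⟦ #good k ⟧ * (t ^ℚ suc k * N) ≤ ⟦ suc k ℕ.* #good (suc k) ⟧
    extension-step = ℚP.≤-trans pairs-lower (ℚP.≤-trans (⟦⟧-mono pairs-upper) (ℚP.≤-reflexive (cong ⟦_⟧ pairs′≡)))

  good-cliques-lower : ∀ r → 0ℚ ≤ t → t ≤ 1ℚ →
    (∀ j → j ℕ.≤ r → ∀ W → t ^ℚ j * N ≤ ⟦ ∣ W ∣ ⟧ → Roomy (ρ * N * N) (τ W)) →
    ∀ k → k ℕ.≤ r → t ^ℚ (suc k C 2) * N ^ℚ k ≤ ⟦ k ! ⟧ * ⟦ #good k ⟧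
  good-cliques-lower r 0≤t t≤1 roomy zero _ =
    ℚP.≤-trans (ℚP.≤-reflexive (ℚP.*-identityˡ 1ℚ)) (*-monoˡ-≤-0≤ (⟦⟧-nonNeg 1) (⟦⟧-mono #good-0))
  good-cliques-lower r 0≤t t≤1 roomy (suc k) k<r = begin
    t ^ℚ (suc (suc k) C 2) * N ^ℚ suc k            ≡⟨ regroup ⟩
    (t ^ℚ (suc k C 2) * N ^ℚ k) * (t ^ℚ suc k * N)  ≤⟨ *-monoʳ-≤-0≤ 0≤c (good-cliques-lower r 0≤t t≤1 roomy k k≤r) ⟩
    (⟦ k ! ⟧ * ⟦ #good k ⟧) * (t ^ℚ suc k * N)      ≡⟨ ℚP.*-assoc ⟦ k ! ⟧ ⟦ #good k ⟧ (t ^ℚ suc k * N) ⟩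
    ⟦ k ! ⟧ * (⟦ #good k ⟧ * (t ^ℚ suc k * N))      ≤⟨ *-monoˡ-≤-0≤ (⟦⟧-nonNeg (k !)) (extension-step k 0≤t t≤1 (roomy k k≤r)) ⟩
    ⟦ k ! ⟧ * ⟦ suc k ℕ.* #good (suc k) ⟧           ≡⟨ factorial ⟩
    ⟦ suc k ! ⟧ * ⟦ #good (suc k) ⟧                 ∎
    where
    open ℚP.≤-Reasoning
    k≤r = ℕP.≤-trans (ℕP.n≤1+n k) k<r
    0≤c : 0ℚ ≤ t ^ℚ suc k * N
    0≤c = *-nonNeg (^-nonNeg (suc k) 0≤t) (⟦⟧-nonNeg n)
    regroup : t ^ℚ (suc (suc k) C 2) * N ^ℚ suc k ≡ (t ^ℚ (suc k C 2) * N ^ℚ k) * (t ^ℚ suc k * N)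
    regroup = trans (cong (λ z → t ^ℚ z * N ^ℚ suc k) (C2-suc (suc k)))
      (trans (cong (_* N ^ℚ suc k) (^-+ t (suc k) (suc k C 2)))
        (solve 4 (λ a b x y → (a :* b) :* (x :* y) := (b :* y) :* (a :* x)) refl (t ^ℚ suc k) (t ^ℚ (suc k C 2)) N (N ^ℚ k)))
    factorial : ⟦ k ! ⟧ * ⟦ suc k ℕ.* #good (suc k) ⟧ ≡ ⟦ suc k ! ⟧ * ⟦ #good (suc k) ⟧
    factorial = trans (cong (⟦ k ! ⟧ *_) (⟦⟧-homo-* (suc k) (#good (suc k))))
      (trans (solve 3 (λ a b c → a :* (b :* c) := (b :* a) :* c) refl ⟦ k ! ⟧ ⟦ suc k ⟧ ⟦ #good (suc k) ⟧)
        (cong (_* ⟦ #good (suc k) ⟧) (sym (⟦⟧-homo-* (suc k) (k !)))))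

rescale : ∀ ρ α N → α ≢ 0ℚ → (ρ /² α) * (α * N) * (α * N) ≡ ρ * N * N
rescale ρ α N α≢0 with α ℚ.≟ 0ℚ
... | yes α≡0 = ⊥-elim (α≢0 α≡0)
... | no  α≢0 = begin
  (ρ * α⁻¹ * α⁻¹) * (α * N) * (α * N)  ≡⟨ solve 4 (λ ρ i a N → (ρ :* i :* i) :* (a :* N) :* (a :* N)
                                                   := ρ :* N :* N :* ((i :* a) :* (i :* a))) refl ρ α⁻¹ α N ⟩
  ρ * N * N * ((α⁻¹ * α) * (α⁻¹ * α))  ≡⟨ cong (λ z → ρ * N * N * (z * z)) (ℚP.*-inverseˡ α {{≢-nonZero α≢0}}) ⟩
  ρ * N * N * (1ℚ * 1ℚ)                ≡⟨ ℚP.*-identityʳ (ρ * N * N) ⟩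
  ρ * N * N                            ∎
  where
  open ≡-Reasoning
  α⁻¹ = (ℚ.1/ α) {{≢-nonZero α≢0}}

dense-on : ∀ {n} (G : Graph n) ρ d α U → Dense G ρ d → ⟦ ∣ U ∣ ⟧ ≡ α * ⟦ n ⟧ → α ≢ 0ℚ → DenseOn G U (ρ /² α) d
dense-on {n} G ρ d α U dense ∣U∣≡αn α≢0 X _ =
  subst (λ z → d * ⟦ ∣ X ∣ C 2 ⟧ - z ≤ ⟦ edgesIn G X ⟧) (sym error≡) (dense X)
  where
  error≡ : (ρ /² α) * ⟦ ∣ U ∣ ⟧ * ⟦ ∣ U ∣ ⟧ ≡ ρ * ⟦ n ⟧ * ⟦ n ⟧
  error≡ = trans (cong (λ z → (ρ /² α) * z * z) ∣U∣≡αn) (rescale ρ α ⟦ n ⟧ α≢0)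

∣∁∣≡ : ∀ {n} (U : Subset n) α → ⟦ ∣ U ∣ ⟧ ≡ α * ⟦ n ⟧ → ⟦ ∣ ∁ U ∣ ⟧ ≡ (1ℚ - α) * ⟦ n ⟧
∣∁∣≡ {n} U α ∣U∣≡αn = begin
  ⟦ ∣ ∁ U ∣ ⟧                  ≡⟨ cong ⟦_⟧ (SubP.∣∁p∣≡n∸∣p∣ U) ⟩
  ⟦ n ℕ.∸ ∣ U ∣ ⟧              ≡⟨ solve 2 (λ x y → x := (x :+ y) :- y) refl ⟦ n ℕ.∸ ∣ U ∣ ⟧ ⟦ ∣ U ∣ ⟧ ⟩
  (⟦ n ℕ.∸ ∣ U ∣ ⟧ + ⟦ ∣ U ∣ ⟧) - ⟦ ∣ U ∣ ⟧
    ≡⟨ cong₂ _-_ (trans (sym (⟦⟧-homo-+ (n ℕ.∸ ∣ U ∣) ∣ U ∣)) (cong ⟦_⟧ (ℕP.m∸n+n≡m (SubP.∣p∣≤n U)))) ∣U∣≡αn ⟩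
  ⟦ n ⟧ - α * ⟦ n ⟧            ≡⟨ solve 2 (λ a N → N :- a :* N := (con 1ℚ :- a) :* N) refl α ⟦ n ⟧ ⟩
  (1ℚ - α) * ⟦ n ⟧             ∎
  where open ≡-Reasoning

ρ-bound : ℚ → ℕ → ℚ
ρ-bound d r = ((d * ½) ^ℚ suc r) * ((d * ½) ^ℚ suc r) * ¼

n-bound : ℚ → ℚ
n-bound ρ = ρ * ⅕

half-bounds : ∀ {d} → 0ℚ ≤ d → d ≤ 1ℚ → 0ℚ ≤ d * ½ × d * ½ ≤ 1ℚ
half-bounds 0≤d d≤1 = *-nonNeg 0≤d (ℚP.<⇒≤ 0<½) ,
  ℚP.≤-trans (*-monoʳ-≤-0≤ (ℚP.<⇒≤ 0<½) d≤1) (toWitness {a? = 1ℚ * ½ ℚ.≤? 1ℚ} tt)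

ρ-bound-pos : ∀ d r → 0ℚ < d → 0ℚ < ρ-bound d r
ρ-bound-pos d r 0<d = *-pos (*-pos P>0 P>0) 0<¼
  where P>0 = ^-pos (suc r) (*-pos 0<d 0<½)

ρ-bound-monoˡ : ∀ d d′ r → 0ℚ ≤ d → d ≤ d′ → ρ-bound d r ≤ ρ-bound d′ r
ρ-bound-monoˡ d d′ r 0≤d d≤d′ = *-monoʳ-≤-0≤ (ℚP.<⇒≤ 0<¼) (*-mono-≤-0≤ 0≤P 0≤P′ P≤P′ P≤P′)
  where
  0≤P = ^-nonNeg (suc r) (*-nonNeg 0≤d (ℚP.<⇒≤ 0<½))
  0≤P′ = ^-nonNeg (suc r) (*-nonNeg (ℚP.≤-trans 0≤d d≤d′) (ℚP.<⇒≤ 0<½))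
  P≤P′ = ^-monoˡ (suc r) (*-nonNeg 0≤d (ℚP.<⇒≤ 0<½)) (*-monoʳ-≤-0≤ (ℚP.<⇒≤ 0<½) d≤d′)

ρ-bound-antitoneʳ : ∀ d r r′ → 0ℚ ≤ d → d ≤ 1ℚ → r′ ℕ.≤ r → ρ-bound d r ≤ ρ-bound d r′
ρ-bound-antitoneʳ d r r′ 0≤d d≤1 r′≤r = *-monoʳ-≤-0≤ (ℚP.<⇒≤ 0<¼) (*-mono-≤-0≤ 0≤P 0≤P′ P≤P′ P≤P′)
  where
  0≤t = proj₁ (half-bounds 0≤d d≤1)
  t≤1 = proj₂ (half-bounds 0≤d d≤1)
  0≤P = ^-nonNeg (suc r) 0≤t
  0≤P′ = ^-nonNeg (suc r′) 0≤t
  P≤P′ = ^-antitone (suc r′) (suc r) 0≤t t≤1 (ℕ.s≤s r′≤r)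

n-bound-pos : ∀ ρ → 0ℚ < ρ → 0ℚ < n-bound ρ
n-bound-pos ρ 0<ρ = *-pos 0<ρ 0<⅕

module Consequences {n} (G : Graph n) (ρ d : ℚ) (dense : Dense G ρ d) (r : ℕ)
                    (0≤d : 0ℚ ≤ d) (d≤1 : d ≤ 1ℚ) (ρ≤ : ρ ≤ ρ-bound d r) (large : 1ℚ ≤ n-bound ρ * ⟦ n ⟧) where
  open GraphFacts G
  open HighDegree G ρ d dense
  open CliqueCount G ρ d dense

  0≤t : 0ℚ ≤ t
  0≤t = proj₁ (half-bounds 0≤d d≤1)

  t≤1 : t ≤ 1ℚ
  t≤1 = proj₂ (half-bounds 0≤d d≤1)

  roomy : ∀ j → j ℕ.≤ r → ∀ W → t ^ℚ j * N ≤ ⟦ ∣ W ∣ ⟧ → Roomy (ρ * N * N) (τ W)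
  roomy j j≤r W big = roomy-if-large (τ W) ρ N P (^-nonNeg (suc r) 0≤t) (^-≤1 (suc r) 0≤t t≤1) PN≤τ ρ≤ large (⟦⟧-nonNeg n)
    where
    P = t ^ℚ suc r
    PN≤τ : P * N ≤ τ W
    PN≤τ = ℚP.≤-trans (ℚP.≤-reflexive (ℚP.*-assoc t (t ^ℚ r) N))
             (*-monoˡ-≤-0≤ 0≤t (ℚP.≤-trans (*-monoʳ-≤-0≤ (⟦⟧-nonNeg n) (^-antitone j r 0≤t t≤1 j≤r)) big))

  high-degree-vertices : Σ (Subset n) (λ S → d * N * ½ ≤ ⟦ ∣ S ∣ ⟧ × (∀ v → lookup S v ≡ true → d * N * ½ ≤ ⟦ degree G v ⟧))
  high-degree-vertices = highIn ⊤ , ℚP.≤-trans (ℚP.≤-reflexive dn/2≡τ) (many-high ⊤ t≤1 (roomy 0 ℕ.z≤n ⊤ whole)) , high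
    where
    dn/2≡τ : d * N * ½ ≡ τ ⊤
    dn/2≡τ = trans (solve 2 (λ d N → d :* N :* con ½ := d :* con ½ :* N) refl d N) (cong (λ z → t * ⟦ z ⟧) (sym (SubP.∣⊤∣≡n n)))
    whole : t ^ℚ 0 * N ≤ ⟦ ∣ ⊤ {n} ∣ ⟧
    whole = ℚP.≤-reflexive (trans (ℚP.*-identityˡ N) (cong ⟦_⟧ (sym (SubP.∣⊤∣≡n n))))
    high : ∀ v → lookup (highIn ⊤) v ≡ true → d * N * ½ ≤ ⟦ degree G v ⟧
    high v v∈ = ℚP.≤-trans (ℚP.≤-reflexive dn/2≡τ) (subst (λ z → τ ⊤ ≤ ⟦ z ⟧) (degIn-⊤ v) (proj₂ (highIn-⊆ ⊤ v v∈)))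

  extendable-cliques : Σ (List (Subset n)) (λ Ks → Unique Ks ×
      All (λ K → IsCopyOfK G r K × Extendable G ((d ^ℚ r) * N * (½ ^ℚ r)) K) Ks ×
      (((d * ½) ^ℚ ((r ℕ.+ 1) C 2)) * (N ^ℚ r)) /! r ≤ ⟦ length Ks ⟧)
  extendable-cliques = Ks , UniqueP.filter⁺ (good? r) (allSubsets-unique n) ,
    All.map (λ {K} → restate {K}) (AllP.all-filter (good? r) (allSubsets n)) ,
    subst (λ m → ((t ^ℚ ((r ℕ.+ 1) C 2)) * (N ^ℚ r)) /! r ≤ ⟦ m ⟧) (sym length≡)
      (/-bound (t ^ℚ ((r ℕ.+ 1) C 2) * N ^ℚ r) ⟦ #good r ⟧ (r !) {{r ℕP.!≢0}}
        (subst (λ m → t ^ℚ (m C 2) * N ^ℚ r ≤ ⟦ r ! ⟧ * ⟦ #good r ⟧) (ℕP.+-comm 1 r)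
          (good-cliques-lower r 0≤t t≤1 roomy r ℕP.≤-refl)))
    where
    Ks = filter (good? r) (allSubsets n)
    length≡ : length Ks ≡ #good r
    length≡ = trans (length-filter (good? r) (allSubsets n)) (sum-allSubsets (𝟙 ∘ good? r))
    restate : ∀ {K} → Good r K → IsCopyOfK G r K × Extendable G ((d ^ℚ r) * N * (½ ^ℚ r)) K
    restate (copy , extendable) = copy , ℚP.≤-trans (ℚP.≤-reflexive size≡) extendable
      where
      size≡ : (d ^ℚ r) * N * (½ ^ℚ r) ≡ t ^ℚ r * N
      size≡ = trans (solve 3 (λ a N b → a :* N :* b := (a :* b) :* N) refl (d ^ℚ r) N (½ ^ℚ r))
                    (cong (_* N) (sym (^-distrib-* d ½ r)))

lemma3 :
  Σ (ℚ → ℕ → ℚ) λ f → Σ (ℚ → ℚ) λ g →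
    -- f(d, 1/r) > 0 and f non-decreasing in d and in 1/r
    (∀ d r → 0ℚ < d → d < 1ℚ → r ≥ 1 → 0ℚ < f d r) ×
    (∀ d d′ r → 0ℚ < d → d ≤ d′ → d′ < 1ℚ → r ≥ 1 → f d r ≤ f d′ r) ×
    (∀ d r r′ → 0ℚ < d → d < 1ℚ → 1 ℕ.≤ r′ → r′ ℕ.≤ r → f d r ≤ f d r′) ×
    -- g(ρ) > 0
    (∀ ρ → 0ℚ < ρ → 0ℚ < g ρ) ×
    (∀ (r n : ℕ) (d α ρ : ℚ) →
      r ≥ 1 →
      0ℚ < d → d < 1ℚ → 0ℚ < α → α < 1ℚ →
      0ℚ < ρ → ρ ≤ f d r →
      -- 1/n ≤ g(ρ), i.e. 1 ≤ g(ρ)·n (with n ≥ 1)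
      n ≥ 1 → 1ℚ ≤ g ρ * ⟦ n ⟧ →
      (G : Graph n) → Dense G ρ d →
      (U : Subset n) → ⟦ ∣ U ∣ ⟧ ≡ α * ⟦ n ⟧ →
        -- (i)
        DenseOn G U (ρ /² α) d
        -- (ii)
      × DenseOn G (∁ U) (ρ /² (1ℚ - α)) d
        -- (iii)
      × Σ (Subset n) (λ S → d * ⟦ n ⟧ * ½ ≤ ⟦ ∣ S ∣ ⟧ ×
          (∀ v → lookup S v ≡ true → d * ⟦ n ⟧ * ½ ≤ ⟦ degree G v ⟧))
        -- (iv)
      × Σ (List (Subset n)) (λ Ks → Unique Ks ×
          All (λ K → IsCopyOfK G r K ×
                     Extendable G ((d ^ℚ r) * ⟦ n ⟧ * (½ ^ℚ r)) K) Ks ×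
          (((d * ½) ^ℚ ((r ℕ.+ 1) C 2)) * (⟦ n ⟧ ^ℚ r)) /! r ≤ ⟦ length Ks ⟧))
lemma3 =
  ρ-bound , n-bound ,
  (λ d r 0<d _ _ → ρ-bound-pos d r 0<d) ,
  (λ d d′ r 0<d d≤d′ _ _ → ρ-bound-monoˡ d d′ r (ℚP.<⇒≤ 0<d) d≤d′) ,
  (λ d r r′ 0<d d<1 _ r′≤r → ρ-bound-antitoneʳ d r r′ (ℚP.<⇒≤ 0<d) (ℚP.<⇒≤ d<1) r′≤r) ,
  n-bound-pos ,
  λ r n d α ρ _ 0<d d<1 0<α α<1 _ ρ≤ _ large G dense U ∣U∣≡αn →
    let open Consequences G ρ d dense r (ℚP.<⇒≤ 0<d) (ℚP.<⇒≤ d<1) ρ≤ large in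
    dense-on G ρ d α U dense ∣U∣≡αn (≢-sym (ℚP.<⇒≢ 0<α)) ,
    dense-on G ρ d (1ℚ - α) (∁ U) dense (∣∁∣≡ U α ∣U∣≡αn) (≢-sym (ℚP.<⇒≢ (p<q⇒0<q-p α<1))) ,
    high-degree-vertices ,
    extendable-cliques
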